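{- Let $\lambda \vdash n$ with $\ell(\lambda) = n-k$ and let $n \geq d \geq k \geq 0$. Then \[ \sum_{\substack{\Lambda \in P[n] :\ \Pi(\lambda) \leq \Lambda \\ \#\Lambda = n-d}} |\mu(\Pi(\lambda), \Lambda)| \leq (n-k)^{2(d-k)}. \]
   Context: $P[n]$ denotes the lattice of set partitions of $[n] = \{1,\dots,n\}$, ordered by $\Lambda \le \Pi$ iff $\Pi$ is obtained from $\Lambda$ by merging blocks of $\Lambda$; $\mu(\cdot,\cdot)$ is the Möbius function of this lattice. $\#\Lambda$ denotes the number of blocks of $\Lambda$. For an integer partition $\lambda = (\lambda_1 \ge \lambda_2 \ge \cdots) \vdash n$ with $\ell(\lambda)$ parts, $\Pi(\lambda)$ is the set partition $\{\{1,\dots,\lambda_1\}, \{\lambda_1+1,\dots,\lambda_1+\lambda_2\}, \dots\}$ of $[n]$ into consecutive blocks of sizes $\lambda_1, \lambda_2, \ldots$. -}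

module Defs where

open import Data.Bool using (Bool; true; false; _∧_; _∨_; not; if_then_else_)
open import Data.Nat using (ℕ; zero; suc; _∸_; _<ᵇ_; _≡ᵇ_; _≥_)
open import Data.Fin using (Fin; toℕ)
open import Data.Integer using (ℤ; -_) renaming (_+_ to _+ℤ_)
open import Data.List using (List; []; _∷_; map; concatMap; allFin; foldr)
open import Data.Nat.ListAction using (sum)
open import Data.List.Relation.Unary.All using (All)
open import Data.List.Relation.Unary.Linked using (Linked)
open import Data.Vec using (Vec; []; _∷_; lookup; tabulate)
import Data.Vec.Properties as VecP
import Data.Bool.Properties as BoolP
open import Relation.Nullary.Decidable using (⌊_⌋)
open import Relation.Binary.PropositionalEquality using (_≡_)

allVecs : {A : Set} → List A → (n : ℕ) → List (Vec A n)
allVecs xs zero    = [] ∷ []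
allVecs xs (suc n) = concatMap (λ x → map (x ∷_) (allVecs xs n)) xs

filterᵇ : {A : Set} → (A → Bool) → List A → List A
filterᵇ p []       = []
filterᵇ p (x ∷ xs) = if p x then x ∷ filterᵇ p xs else filterᵇ p xs

countᵇ : {A : Set} → (A → Bool) → List A → ℕ
countᵇ p []       = 0
countᵇ p (x ∷ xs) = if p x then suc (countᵇ p xs) else countᵇ p xs

all : {A : Set} → (A → Bool) → List A → Bool
all p = foldr (λ x b → p x ∧ b) true

sumℤ : List ℤ → ℤ
sumℤ = foldr _+ℤ_ (ℤ.pos 0)

_⇒ᵇ_ : Bool → Bool → Bool
a ⇒ᵇ b = not a ∨ b

-- Set partitions of [n] = {0,…,n-1}, represented (canonically) as
-- equivalence relations on Fin n given by Boolean n×n matrices: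
-- rel R i j = true  iff  i and j lie in the same block.

Rel : ℕ → Set
Rel n = Vec (Vec Bool n) n

rel : {n : ℕ} → Rel n → Fin n → Fin n → Bool
rel R i j = lookup (lookup R i) j

isEquiv : {n : ℕ} → Rel n → Bool
isEquiv {n} R =
  all (λ i → rel R i i) (allFin n) ∧
  all (λ i → all (λ j → rel R i j ⇒ᵇ rel R j i) (allFin n)) (allFin n) ∧
  all (λ i → all (λ j → all (λ k → (rel R i j ∧ rel R j k) ⇒ᵇ rel R i k)
                                (allFin n)) (allFin n)) (allFin n)

P : (n : ℕ) → List (Rel n)
P n = filterᵇ isEquiv (allVecs (allVecs (true ∷ false ∷ []) n) n)

_==_ : {n : ℕ} → Rel n → Rel n → Bool
R == S = ⌊ VecP.≡-dec (VecP.≡-dec BoolP._≟_) R S ⌋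

-- Λ ≤ Π  iff every block of Λ is contained in a block of Π
-- (Π is obtained from Λ by merging blocks)
_≤P_ : {n : ℕ} → Rel n → Rel n → Bool
_≤P_ {n} R S = all (λ i → all (λ j → rel R i j ⇒ᵇ rel S i j) (allFin n)) (allFin n)

-- #Λ : number of blocks = number of elements that are the least element
-- of their block
#_ : {n : ℕ} → Rel n → ℕ
#_ {n} R = countᵇ (λ i → all (λ j → (toℕ j <ᵇ toℕ i) ⇒ᵇ not (rel R j i)) (allFin n)) (allFin n)

-- The recursion is run with a fuel argument; fuel n suffices since every
-- strict chain in P[n] has length ≤ n - 1.

μ-fuel : {n : ℕ} → ℕ → Rel n → Rel n → ℤ
μ-fuel zero x y = if x == y then ℤ.pos 1 else ℤ.pos 0
μ-fuel {n} (suc f) x y =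
  if x == y then ℤ.pos 1
  else if x ≤P y
    then - sumℤ (map (μ-fuel f x)
                     (filterᵇ (λ z → (x ≤P z) ∧ (z ≤P y) ∧ not (z == y)) (P n)))
    else ℤ.pos 0

μ : {n : ℕ} → Rel n → Rel n → ℤ
μ {n} = μ-fuel n

record _⊢_ (λs : List ℕ) (n : ℕ) : Set where
  field
    positive   : All (λ p → p ≥ 1) λs
    decreasing : Linked _≥_ λs
    sums       : sum λs ≡ n

-- index (0-based) of the consecutive block of Π(λ) containing element i
blockOf : List ℕ → ℕ → ℕ
blockOf []       i = 0
blockOf (p ∷ ps) i = if i <ᵇ p then 0 else suc (blockOf ps (i ∸ p))

Πof : (n : ℕ) → List ℕ → Rel n
Πof n λs = tabulate (λ i → tabulate (λ j → blockOf λs (toℕ i) ≡ᵇ blockOf λs (toℕ j)))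

mobiusSum : (n : ℕ) → List ℕ → ℕ → ℕ
mobiusSum n λs m =
  sum (map (λ Λ → Data.Integer.∣ μ (Πof n λs) Λ ∣)
           (filterᵇ (λ Λ → (Πof n λs ≤P Λ) ∧ (# Λ ≡ᵇ m)) (P n)))

-- Let p be the number of blocks of Π = Π(λ) and S(c) the sum of |μ(Π,Λ)| over the coarsenings Λ of Π
-- with c blocks. The recursion μ(Π,Λ) = −Σ_{Π ≤ z < Λ} μ(Π,z) gives S(c) ≤ [p = c] + Σ_z |μ(Π,z)|·N(z,c),
-- where N(z,c) counts the strict coarsenings of z with c blocks. Such a coarsening is determined by where
-- it sends each block minimum of z (to itself, or to an earlier block minimum), and counting these codes
-- gives N(z,c)·2^(b−c) ≤ b^(2(b−c)) for b = #z. Weighting level b by 2^(p−b), induction yields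
-- S(c)·2^(p−c) ≤ p^(2(p−c))·(1 + Σ_{c<b≤p} 2^(p−b)) ≤ p^(2(p−c))·2^(p−c); finally p ≤ ℓ(λ) = n − k.

module Submission where

open import Defs
open import Data.Bool using (Bool; true; false; _∧_; not; if_then_else_)
open import Data.Bool.Properties as Bool using (∧-conicalˡ; ∧-conicalʳ; T-≡; ¬-not)
open import Data.Nat
open import Data.Nat.Properties
open import Data.Nat.ListAction using (sum)
open import Data.List using (List; []; _∷_; _++_; map; concatMap; length; downFrom; upTo; allFin)
open import Data.List.Properties using (length-++; length-map; length-upTo)
open import Data.List.Membership.Propositional using (_∈_)
open import Data.List.Relation.Unary.Any as Any using (here; there)
open import Data.List.Membership.Propositional.Properties
  using (∈-map⁺; ∈-map⁻; ∈-concatMap⁺; ∈-allFin; ∈-++⁺ˡ; ∈-++⁺ʳ; ∈-upTo⁺; ∈-downFrom⁺; ∈-downFrom⁻)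
open import Data.List.Relation.Unary.All as All using ([]; _∷_)
open import Data.List.Relation.Unary.AllPairs using ([]; _∷_)
open import Data.Vec as Vec using (Vec; []; _∷_)
import Data.Vec.Properties as Vec
open import Data.List.Relation.Unary.Unique.Propositional using (Unique)
open import Data.List.Relation.Unary.Unique.Propositional.Properties using (allFin⁺)
open import Data.Nat.Tactic.RingSolver using (solve-∀)
open import Data.Sum using (_⊎_; inj₁; inj₂)
open import Data.Integer using (ℤ; ∣_∣; -_)
import Data.Integer.Properties as ℤ
open import Data.Product using (∃; _×_; _,_; proj₁; proj₂; map₁)
open import Data.Empty using (⊥-elim)
open import Function using (_∘_; case_of_)
open import Function.Bundles using (Equivalence; _⇔_; mk⇔)
open import Data.Fin using (Fin; zero; suc; toℕ)
open import Data.Fin.Properties using (toℕ-injective; toℕ<n)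
open import Data.Maybe as Maybe using (Maybe; just; nothing; fromMaybe)
open import Relation.Binary.Structures using (IsEquivalence)
open import Relation.Binary.Definitions using (tri<; tri≈; tri>)
open import Algebra.Properties.CommutativeSemigroup +-commutativeSemigroup
  using () renaming (interchange to +-interchange)
open import Relation.Binary.PropositionalEquality
  using (_≡_; _≢_; refl; sym; trans; cong; cong₂; subst; module ≡-Reasoning)
open import Relation.Nullary using (¬_; yes; no)
open import Relation.Nullary.Decidable using (Dec; does; dec-true)
open import Relation.Binary.Definitions using (DecidableEquality)

private variable
  A B : Set

[_]×_ : Bool → ℕ → ℕ
[ true  ]× x = x
[ false ]× x = 0

infixr 8 [_]×_

[]×-≤ : ∀ b x → [ b ]× x ≤ x
[]×-≤ true  x = ≤-refl
[]×-≤ false x = z≤n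

[]×-mono : ∀ b {x y} → x ≤ y → [ b ]× x ≤ [ b ]× y
[]×-mono true  x≤y = x≤y
[]×-mono false x≤y = z≤n

[]×-∧ : ∀ a b x → [ a ∧ b ]× x ≡ [ a ]× [ b ]× x
[]×-∧ true  b x = refl
[]×-∧ false b x = refl

[]×-+ : ∀ b x y → [ b ]× (x + y) ≡ [ b ]× x + [ b ]× y
[]×-+ true  x y = refl
[]×-+ false x y = refl

[]×-*ʳ : ∀ b x y → ([ b ]× x) * y ≡ [ b ]× (x * y)
[]×-*ʳ true  x y = refl
[]×-*ʳ false x y = refl

<⇒<ᵇ≡true : ∀ {m n} → m < n → (m <ᵇ n) ≡ true
<⇒<ᵇ≡true = Equivalence.to T-≡ ∘ <⇒<ᵇ

<ᵇ≡true⇒< : ∀ m n → (m <ᵇ n) ≡ true → m < n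
<ᵇ≡true⇒< m n = <ᵇ⇒< m n ∘ Equivalence.from T-≡

≡ᵇ≡true⇒≡ : ∀ m n → (m ≡ᵇ n) ≡ true → m ≡ n
≡ᵇ≡true⇒≡ m n = ≡ᵇ⇒≡ m n ∘ Equivalence.from T-≡

≡⇒≡ᵇ≡true : ∀ {m n} → m ≡ n → (m ≡ᵇ n) ≡ true
≡⇒≡ᵇ≡true = Equivalence.to T-≡ ∘ ≡⇒≡ᵇ _ _

∑ : List A → (A → ℕ) → ℕ
∑ []       f = 0
∑ (x ∷ xs) f = f x + ∑ xs f

infix 5 ∑
syntax ∑ xs (λ x → e) = ∑[ x ∈ xs ] e

module _ {f g : A → ℕ} where

  ∑-cong : ∀ xs → (∀ x → f x ≡ g x) → ∑ xs f ≡ ∑ xs g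
  ∑-cong []       f≗g = refl
  ∑-cong (x ∷ xs) f≗g = cong₂ _+_ (f≗g x) (∑-cong xs f≗g)

  ∑-mono : ∀ xs → (∀ x → x ∈ xs → f x ≤ g x) → ∑ xs f ≤ ∑ xs g
  ∑-mono []       f≤g = z≤n
  ∑-mono (x ∷ xs) f≤g = +-mono-≤ (f≤g x (here refl)) (∑-mono xs (λ y → f≤g y ∘ there))

  ∑-+ : ∀ xs → ∑[ x ∈ xs ] (f x + g x) ≡ ∑ xs f + ∑ xs g
  ∑-+ []       = refl
  ∑-+ (x ∷ xs) = trans (cong (f x + g x +_) (∑-+ xs)) (+-interchange (f x) (g x) (∑ xs f) (∑ xs g))

∑-*ˡ : ∀ k (f : A → ℕ) xs → ∑[ x ∈ xs ] (k * f x) ≡ k * ∑ xs f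
∑-*ˡ k f []       = sym (*-zeroʳ k)
∑-*ˡ k f (x ∷ xs) = trans (cong (k * f x +_) (∑-*ˡ k f xs)) (sym (*-distribˡ-+ k (f x) (∑ xs f)))

∑-*ʳ : ∀ k (f : A → ℕ) xs → ∑[ x ∈ xs ] (f x * k) ≡ ∑ xs f * k
∑-*ʳ k f xs = trans (∑-cong xs (λ x → *-comm (f x) k)) (trans (∑-*ˡ k f xs) (*-comm k (∑ xs f)))

∑-zero : ∀ (xs : List A) → ∑[ x ∈ xs ] 0 ≡ 0
∑-zero []       = refl
∑-zero (x ∷ xs) = ∑-zero xs

∑-vanish : ∀ {f : A → ℕ} xs → (∀ x → x ∈ xs → f x ≡ 0) → ∑ xs f ≡ 0
∑-vanish xs f≡0 = n≤0⇒n≡0 (≤-trans (∑-mono xs (λ x x∈ → ≤-reflexive (f≡0 x x∈))) (≤-reflexive (∑-zero xs)))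

∑-member : ∀ {f : A → ℕ} {x xs} → x ∈ xs → f x ≤ ∑ xs f
∑-member {f = f} {xs = y ∷ ys} (here refl) = m≤m+n (f y) (∑ ys f)
∑-member {f = f} {xs = y ∷ ys} (there x∈) = ≤-trans (∑-member x∈) (m≤n+m (∑ ys f) (f y))

∑-swap : ∀ (xs : List A) (ys : List B) (f : A → B → ℕ) →
         ∑[ x ∈ xs ] ∑[ y ∈ ys ] f x y ≡ ∑[ y ∈ ys ] ∑[ x ∈ xs ] f x y
∑-swap []       ys f = sym (∑-zero ys)
∑-swap (x ∷ xs) ys f = trans (cong (∑ ys (f x) +_) (∑-swap xs ys f)) (sym (∑-+ ys))

∑-[]× : ∀ b (f : A → ℕ) xs → [ b ]× ∑ xs f ≡ ∑[ x ∈ xs ] [ b ]× f x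
∑-[]× true  f xs = refl
∑-[]× false f xs = sym (∑-zero xs)

∑-++ : ∀ (f : A → ℕ) xs ys → ∑ (xs ++ ys) f ≡ ∑ xs f + ∑ ys f
∑-++ f []       ys = refl
∑-++ f (x ∷ xs) ys = trans (cong (f x +_) (∑-++ f xs ys)) (sym (+-assoc (f x) _ _))

∑-map : ∀ (h : A → B) (f : B → ℕ) xs → ∑ (map h xs) f ≡ ∑ xs (f ∘ h)
∑-map h f []       = refl
∑-map h f (x ∷ xs) = cong (f (h x) +_) (∑-map h f xs)

∑-concatMap : ∀ (h : A → List B) (f : B → ℕ) xs → ∑ (concatMap h xs) f ≡ ∑[ x ∈ xs ] ∑ (h x) f
∑-concatMap h f []       = refl
∑-concatMap h f (x ∷ xs) = trans (∑-++ f (h x) (concatMap h xs)) (cong (∑ (h x) f +_) (∑-concatMap h f xs))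

∑-const : ∀ (xs : List A) k → ∑[ x ∈ xs ] k ≡ length xs * k
∑-const []       k = refl
∑-const (x ∷ xs) k = cong (k +_) (∑-const xs k)

∑-filterᵇ : ∀ (p : A → Bool) (f : A → ℕ) xs → ∑ (filterᵇ p xs) f ≡ ∑[ x ∈ xs ] [ p x ]× f x
∑-filterᵇ p f []       = refl
∑-filterᵇ p f (x ∷ xs) with p x
... | true  = cong (f x +_) (∑-filterᵇ p f xs)
... | false = ∑-filterᵇ p f xs

sum-map : ∀ (f : A → ℕ) xs → sum (map f xs) ≡ ∑ xs f
sum-map f []       = refl
sum-map f (x ∷ xs) = cong (f x +_) (sum-map f xs)

countᵇ-∑ : ∀ (p : A → Bool) xs → countᵇ p xs ≡ ∑[ x ∈ xs ] [ p x ]× 1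
countᵇ-∑ p []       = refl
countᵇ-∑ p (x ∷ xs) with p x
... | true  = cong suc (countᵇ-∑ p xs)
... | false = countᵇ-∑ p xs

∑-positive : ∀ {f : A → ℕ} xs → 0 < ∑ xs f → ∃ λ x → x ∈ xs × 0 < f x
∑-positive {f = f} (x ∷ xs) 0<∑ with f x in fx
... | suc _ = x , here refl , subst (0 <_) (sym fx) z<s
... | zero  with y , y∈ , 0<fy ← ∑-positive xs 0<∑ = y , there y∈ , 0<fy

∑-group : ∀ (xs : List A) (ks : List ℕ) (deg : A → ℕ) (q : A → Bool) (g : A → ℕ) (w : ℕ → ℕ) →
          (∀ {x} → x ∈ xs → q x ≡ true → deg x ∈ ks) →
          ∑[ x ∈ xs ] [ q x ]× (g x * w (deg x)) ≤ ∑[ k ∈ ks ] (∑[ x ∈ xs ] [ q x ∧ (deg x ≡ᵇ k) ]× g x) * w k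
∑-group xs ks deg q g w deg∈ = begin
  ∑[ x ∈ xs ] [ q x ]× (g x * w (deg x))                       ≤⟨ ∑-mono xs (λ x x∈ → atDegree x∈) ⟩
  ∑[ x ∈ xs ] ∑[ k ∈ ks ] [ q x ∧ (deg x ≡ᵇ k) ]× (g x * w k)  ≡⟨ ∑-swap xs ks _ ⟩
  ∑[ k ∈ ks ] ∑[ x ∈ xs ] [ q x ∧ (deg x ≡ᵇ k) ]× (g x * w k)  ≡⟨ ∑-cong ks factor ⟩
  ∑[ k ∈ ks ] (∑[ x ∈ xs ] [ q x ∧ (deg x ≡ᵇ k) ]× g x) * w k  ∎
  where
  open ≤-Reasoning
  atDegree : ∀ {x} → x ∈ xs → [ q x ]× (g x * w (deg x)) ≤ ∑[ k ∈ ks ] [ q x ∧ (deg x ≡ᵇ k) ]× (g x * w k)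
  atDegree {x} x∈ with q x in qx
  ... | false = z≤n
  ... | true  = ≤-trans (≤-reflexive (cong ([_]× (g x * w (deg x))) (sym (≡⇒≡ᵇ≡true {deg x} refl))))
                        (∑-member {f = λ k → [ deg x ≡ᵇ k ]× (g x * w k)} (deg∈ x∈ qx))
  factor : ∀ k → ∑[ x ∈ xs ] [ q x ∧ (deg x ≡ᵇ k) ]× (g x * w k)
               ≡ (∑[ x ∈ xs ] [ q x ∧ (deg x ≡ᵇ k) ]× g x) * w k
  factor k = trans (∑-cong xs (λ x → sym ([]×-*ʳ (q x ∧ (deg x ≡ᵇ k)) (g x) (w k)))) (∑-*ʳ (w k) _ xs)

0<ᵇ⇒0< : ∀ k → (0 <ᵇ k) ≡ true → 0 < k
0<ᵇ⇒0< (suc k) _ = z<s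

[]×1-positive : ∀ {b} → 0 < [ b ]× 1 → b ≡ true
[]×1-positive {true} _ = refl

AtMostOneIn : List A → (A → Bool) → Set
AtMostOneIn xs q = ∀ {x y} → x ∈ xs → y ∈ xs → q x ≡ true → q y ≡ true → x ≡ y

-- Phrased by counting, rather than via Unique, so that it passes through concatMap directly.
Distinct : List A → Set
Distinct xs = ∀ q → AtMostOneIn xs q → ∑[ x ∈ xs ] [ q x ]× 1 ≤ 1

Unique⇒Distinct : {xs : List A} → Unique xs → Distinct xs
Unique⇒Distinct []               q one = z≤n
Unique⇒Distinct {xs = x ∷ xs} (x≢xs ∷ u) q one with q x in qx
... | false = Unique⇒Distinct u q (λ x∈ y∈ → one (there x∈) (there y∈))
... | true  = s≤s (≤-reflexive (∑-vanish xs noOther))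
  where
  noOther : ∀ y → y ∈ xs → [ q y ]× 1 ≡ 0
  noOther y y∈ with q y in qy
  ... | false = refl
  ... | true  = ⊥-elim (All.lookup x≢xs y∈ (one (here refl) (there y∈) qx qy))

∈-filterᵇ⁺ : ∀ (p : A → Bool) {x xs} → x ∈ xs → p x ≡ true → x ∈ filterᵇ p xs
∈-filterᵇ⁺ p {xs = y ∷ ys} x∈ px with p y in py
∈-filterᵇ⁺ p (here refl) px | true  = here refl
∈-filterᵇ⁺ p (there x∈)  px | true  = there (∈-filterᵇ⁺ p x∈ px)
∈-filterᵇ⁺ p (here refl) px | false with () ← trans (sym px) py
∈-filterᵇ⁺ p (there x∈)  px | false = ∈-filterᵇ⁺ p x∈ px

∈-filterᵇ⁻ : ∀ (p : A → Bool) {x xs} → x ∈ filterᵇ p xs → x ∈ xs × p x ≡ true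
∈-filterᵇ⁻ p {xs = y ∷ ys} x∈ with p y in py
∈-filterᵇ⁻ p (here refl) | true = here refl , py
∈-filterᵇ⁻ p (there x∈)  | true = map₁ there (∈-filterᵇ⁻ p x∈)
... | false = map₁ there (∈-filterᵇ⁻ p x∈)

Distinct-filterᵇ : ∀ (p : A → Bool) {xs} → Distinct xs → Distinct (filterᵇ p xs)
Distinct-filterᵇ p {xs} distinct q one = begin
  ∑[ x ∈ filterᵇ p xs ] [ q x ]× 1  ≡⟨ ∑-filterᵇ p _ xs ⟩
  ∑[ x ∈ xs ] [ p x ]× [ q x ]× 1   ≡⟨ ∑-cong xs (λ x → sym ([]×-∧ (p x) (q x) 1)) ⟩
  ∑[ x ∈ xs ] [ p x ∧ q x ]× 1      ≤⟨ distinct _ one′ ⟩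
  1                                 ∎
  where
  open ≤-Reasoning
  one′ : AtMostOneIn xs (λ x → p x ∧ q x)
  one′ x∈ y∈ pqx pqy = one (∈-filterᵇ⁺ p x∈ (∧-conicalˡ _ _ pqx)) (∈-filterᵇ⁺ p y∈ (∧-conicalˡ _ _ pqy))
                           (∧-conicalʳ _ _ pqx) (∧-conicalʳ _ _ pqy)

Distinct-map : ∀ {h : A → B} {xs} → (∀ {x y} → h x ≡ h y → x ≡ y) → Distinct xs → Distinct (map h xs)
Distinct-map {h = h} {xs} h-injective distinct q one = begin
  ∑[ y ∈ map h xs ] [ q y ]× 1  ≡⟨ ∑-map h _ xs ⟩
  ∑[ x ∈ xs ] [ q (h x) ]× 1    ≤⟨ distinct (q ∘ h) one′ ⟩
  1                             ∎
  where
  open ≤-Reasoning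
  one′ : AtMostOneIn xs (q ∘ h)
  one′ x∈ y∈ qx qy = h-injective (one (∈-map⁺ h x∈) (∈-map⁺ h y∈) qx qy)

∑≤1 : ∀ {f : A → ℕ} {xs} → Distinct xs → (∀ x → x ∈ xs → f x ≤ 1) → AtMostOneIn xs (λ x → 0 <ᵇ f x) →
      ∑ xs f ≤ 1
∑≤1 {f = f} {xs} distinct f≤1 one = ≤-trans (∑-mono xs (λ x x∈ → ≤[0<ᵇ]×1 (f x) (f≤1 x x∈))) (distinct _ one)
  where
  ≤[0<ᵇ]×1 : ∀ k → k ≤ 1 → k ≤ [ 0 <ᵇ k ]× 1
  ≤[0<ᵇ]×1 zero          _           = z≤n
  ≤[0<ᵇ]×1 (suc zero)    _           = ≤-refl
  ≤[0<ᵇ]×1 (suc (suc k)) (s≤s ())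

Distinct-concatMap : ∀ {A B : Set} {h : A → List B} {xs} (tag : B → A) → (∀ {x y} → y ∈ h x → tag y ≡ x) →
                     Distinct xs → (∀ x → Distinct (h x)) → Distinct (concatMap h xs)
Distinct-concatMap {A} {B} {h} {xs} tag tagged distinct distinctₕ q one = begin
  ∑[ y ∈ concatMap h xs ] [ q y ]× 1  ≡⟨ ∑-concatMap h _ xs ⟩
  ∑[ x ∈ xs ] hits x                 ≤⟨ ∑≤1 distinct (λ x x∈ → distinctₕ x q (one′ x∈)) one″ ⟩
  1                                  ∎
  where
  open ≤-Reasoning
  hits : A → ℕ
  hits x = ∑[ y ∈ h x ] [ q y ]× 1
  witness : ∀ x → (0 <ᵇ hits x) ≡ true → ∃ λ y → y ∈ h x × q y ≡ true
  witness x 0<hits with y , y∈ , 0<qy ← ∑-positive (h x) (0<ᵇ⇒0< (hits x) 0<hits) = y , y∈ , []×1-positive 0<qy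
  inConcat : ∀ {x y} → x ∈ xs → y ∈ h x → y ∈ concatMap h xs
  inConcat x∈ y∈ = ∈-concatMap⁺ h (Any.map (λ { refl → y∈ }) x∈)
  one′ : ∀ {x} → x ∈ xs → AtMostOneIn (h x) q
  one′ x∈ y∈ y′∈ = one (inConcat x∈ y∈) (inConcat x∈ y′∈)
  one″ : AtMostOneIn xs (λ x → 0 <ᵇ hits x)
  one″ {x} {x′} x∈ x′∈ hx hx′
    with y  , y∈  , qy  ← witness x  hx
       | y′ , y′∈ , qy′ ← witness x′ hx′ =
    trans (sym (tagged y∈)) (trans (cong tag (one (inConcat x∈ y∈) (inConcat x′∈ y′∈) qy qy′)) (tagged y′∈))

Distinct-allVecs : ∀ {xs : List A} → Distinct xs → ∀ n → Distinct (allVecs xs n)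
Distinct-allVecs distinct zero    q one = ≤-trans (≤-reflexive (+-identityʳ _)) ([]×-≤ (q []) 1)
Distinct-allVecs distinct (suc n) =
  Distinct-concatMap Vec.head tagged distinct (λ x → Distinct-map Vec.∷-injectiveʳ (Distinct-allVecs distinct n))
  where
  tagged : ∀ {x v} → v ∈ map (x ∷_) (allVecs _ n) → Vec.head v ≡ x
  tagged v∈ with _ , _ , refl ← ∈-map⁻ _ v∈ = refl

Distinct-P : ∀ n → Distinct (P n)
Distinct-P n = Distinct-filterᵇ isEquiv (Distinct-allVecs (Distinct-allVecs distinctBool n) n)
  where
  distinctBool : Distinct (true ∷ false ∷ [])
  distinctBool = Unique⇒Distinct (((λ ()) ∷ []) ∷ [] ∷ [])

count-by-code : ∀ {A B : Set} {xs : List A} (_≟_ : DecidableEquality B) (code : A → B) (q : A → Bool) (ks : List B) →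
                Distinct xs → (∀ {x} → x ∈ xs → q x ≡ true → code x ∈ ks) →
                (∀ {x y} → x ∈ xs → y ∈ xs → q x ≡ true → q y ≡ true → code x ≡ code y → x ≡ y) →
                ∑[ x ∈ xs ] [ q x ]× 1 ≤ length ks
count-by-code {A} {B} {xs} _≟_ code q ks distinct code∈ code-injective = begin
  ∑[ x ∈ xs ] [ q x ]× 1                  ≤⟨ ∑-mono xs (λ x x∈ → atCode x∈) ⟩
  ∑[ x ∈ xs ] ∑[ k ∈ ks ] [ hit x k ]× 1  ≡⟨ ∑-swap xs ks _ ⟩
  ∑[ k ∈ ks ] ∑[ x ∈ xs ] [ hit x k ]× 1  ≤⟨ ∑-mono ks (λ k _ → distinct (λ x → hit x k) (one k)) ⟩
  ∑[ k ∈ ks ] 1                           ≡⟨ ∑-const ks 1 ⟩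
  length ks * 1                           ≡⟨ *-identityʳ _ ⟩
  length ks                               ∎
  where
  open ≤-Reasoning
  hit : A → B → Bool
  hit x k = q x ∧ does (code x ≟ k)
  atCode : ∀ {x} → x ∈ xs → [ q x ]× 1 ≤ ∑[ k ∈ ks ] [ hit x k ]× 1
  atCode {x} x∈ with q x in qx
  ... | false = z≤n
  ... | true  = ≤-trans (≤-reflexive (cong ([_]× 1) (sym (dec-true (code x ≟ code x) refl)))) (∑-member (code∈ x∈ qx))
  one : ∀ k → AtMostOneIn xs (λ x → hit x k)
  one k x∈ y∈ hx hy = code-injective x∈ y∈ (∧-conicalˡ _ _ hx) (∧-conicalˡ _ _ hy)
    (trans (does⇒ (code _ ≟ k) (∧-conicalʳ _ _ hx)) (sym (does⇒ (code _ ≟ k) (∧-conicalʳ _ _ hy))))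
    where
    does⇒ : ∀ {X : Set} (d : Dec X) → does d ≡ true → X
    does⇒ (yes x) _ = x

all-sound : ∀ (q : A → Bool) {xs x} → all q xs ≡ true → x ∈ xs → q x ≡ true
all-sound q {y ∷ ys} qs (here refl) = ∧-conicalˡ _ _ qs
all-sound q {y ∷ ys} qs (there x∈)  = all-sound q (∧-conicalʳ (q y) _ qs) x∈

all-complete : ∀ (q : A → Bool) xs → (∀ x → q x ≡ true) → all q xs ≡ true
all-complete q []       qs = refl
all-complete q (x ∷ xs) qs = cong₂ _∧_ (qs x) (all-complete q xs qs)

⇒ᵇ-elim : ∀ {a b} → (a ⇒ᵇ b) ≡ true → a ≡ true → b ≡ true
⇒ᵇ-elim a⇒b refl = a⇒b

⇒ᵇ-intro : ∀ {a b} → (a ≡ true → b ≡ true) → (a ⇒ᵇ b) ≡ true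
⇒ᵇ-intro {true}  a→b = a→b refl
⇒ᵇ-intro {false} a→b = refl

module _ {n : ℕ} where

  _∼[_]_ : Fin n → Rel n → Fin n → Set
  i ∼[ R ] j = rel R i j ≡ true

  IsPartition : Rel n → Set
  IsPartition R = IsEquivalence (λ i j → i ∼[ R ] j)

  all-Fin : ∀ (q : Fin n → Bool) → all q (allFin n) ≡ true → ∀ i → q i ≡ true
  all-Fin q qs i = all-sound q qs (∈-allFin i)

  isEquiv-sound : ∀ {R : Rel n} → isEquiv R ≡ true → IsPartition R
  isEquiv-sound {R} equiv = record
    { refl  = λ {i} → all-Fin reflexive (∧-conicalˡ _ _ equiv) i
    ; sym   = λ {i} {j} → ⇒ᵇ-elim (all-Fin (symmetric i) (all-Fin _ (∧-conicalˡ _ _ equiv₂) i) j)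
    ; trans = λ {i} {j} {k} i∼j j∼k →
        ⇒ᵇ-elim (all-Fin (transitive i j) (all-Fin _ (all-Fin _ (∧-conicalʳ _ _ equiv₂) i) j) k) (cong₂ _∧_ i∼j j∼k)
    }
    where
    reflexive : Fin n → Bool
    reflexive i = rel R i i
    symmetric : Fin n → Fin n → Bool
    symmetric i j = rel R i j ⇒ᵇ rel R j i
    transitive : Fin n → Fin n → Fin n → Bool
    transitive i j k = (rel R i j ∧ rel R j k) ⇒ᵇ rel R i k
    symmetries transitivities : Bool
    symmetries     = all (λ i → all (symmetric i) (allFin n)) (allFin n)
    transitivities = all (λ i → all (λ j → all (transitive i j) (allFin n)) (allFin n)) (allFin n)
    equiv₂ : (symmetries ∧ transitivities) ≡ true
    equiv₂ = ∧-conicalʳ (all reflexive (allFin n)) _ equiv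

  ∈P⇒IsPartition : ∀ {R : Rel n} → R ∈ P n → IsPartition R
  ∈P⇒IsPartition {R} R∈ =
    isEquiv-sound {R = R} (proj₂ (∈-filterᵇ⁻ isEquiv {xs = allVecs (allVecs (true ∷ false ∷ []) n) n} R∈))

  record _⊑_ (R S : Rel n) : Set where
    constructor mk⊑
    field coarsen : ∀ {i j} → i ∼[ R ] j → i ∼[ S ] j
  open _⊑_ public

  ≤P-sound : ∀ R S → (R ≤P S) ≡ true → R ⊑ S
  ≤P-sound R S R≤S = mk⊑ λ {i} {j} → ⇒ᵇ-elim (all-Fin _ (all-Fin _ R≤S i) j)

  ==-sound : ∀ {R S : Rel n} → (R == S) ≡ true → R ≡ S
  ==-sound {R} {S} R==S with Vec.≡-dec (Vec.≡-dec Bool._≟_) R S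
  ... | yes R≡S = R≡S

  ==-refl : ∀ (R : Rel n) → (R == R) ≡ true
  ==-refl R with Vec.≡-dec (Vec.≡-dec Bool._≟_) R R
  ... | yes _   = refl
  ... | no R≢R = ⊥-elim (R≢R refl)

  rel-ext : ∀ {R S : Rel n} → (∀ i j → rel R i j ≡ rel S i j) → R ≡ S
  rel-ext {R} {S} R≗S = begin
    R                                                ≡⟨ Vec.tabulate∘lookup R ⟨
    Vec.tabulate (λ i → Vec.lookup R i)              ≡⟨ Vec.tabulate-cong row≡ ⟩
    Vec.tabulate (λ i → Vec.lookup S i)              ≡⟨ Vec.tabulate∘lookup S ⟩
    S                                                ∎
    where
    open ≡-Reasoning
    row≡ : ∀ i → Vec.lookup R i ≡ Vec.lookup S i
    row≡ i = trans (sym (Vec.tabulate∘lookup _)) (trans (Vec.tabulate-cong (R≗S i)) (Vec.tabulate∘lookup _))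

  -- # R is definitionally countᵇ (isMin R) (allFin n).
  isMin : Rel n → Fin n → Bool
  isMin R i = all (λ j → (toℕ j <ᵇ toℕ i) ⇒ᵇ not (rel R j i)) (allFin n)

  isMin-sound : ∀ {R : Rel n} {i j} → isMin R i ≡ true → toℕ j < toℕ i → ¬ j ∼[ R ] i
  isMin-sound {R} {i} {j} min j<i j∼i
    with () ← subst (λ b → not b ≡ true) j∼i (⇒ᵇ-elim (all-Fin _ min j) (<⇒<ᵇ≡true j<i))

  isMin-complete : ∀ {R : Rel n} {i} → (∀ j → toℕ j < toℕ i → ¬ j ∼[ R ] i) → isMin R i ≡ true
  isMin-complete below =
    all-complete _ (allFin n) (λ j → ⇒ᵇ-intro (λ j<ᵇi → cong not (¬-not (below j (<ᵇ≡true⇒< (toℕ j) _ j<ᵇi)))))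

  isMin-antitone : ∀ {R S : Rel n} → R ⊑ S → ∀ {i} → isMin S i ≡ true → isMin R i ≡ true
  isMin-antitone {R} {S} R⊑S minS = isMin-complete {R = R} (λ j j<i j∼i → isMin-sound {R = S} minS j<i (coarsen R⊑S j∼i))

first : ∀ {m} → (Fin m → Bool) → Maybe (Fin m)
first {zero}  p = nothing
first {suc m} p = if p zero then just zero else Maybe.map suc (first (p ∘ suc))

first-least : ∀ {m} (p : Fin m → Bool) {i} → p i ≡ true →
              ∃ λ k → first p ≡ just k × p k ≡ true × (∀ {j} → p j ≡ true → toℕ k ≤ toℕ j)
first-least {suc m} p {i} pi with p zero in p0
... | true = zero , refl , p0 , λ _ → z≤n
first-least {suc m} p {zero}  pi | false with () ← trans (sym pi) p0
first-least {suc m} p {suc i} pi | false with k , firstₖ , pk , least ← first-least (p ∘ suc) pi =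
  suc k , cong (Maybe.map suc) firstₖ , pk , least′
  where
  least′ : ∀ {j} → p j ≡ true → toℕ (suc k) ≤ toℕ j
  least′ {zero}  pj with () ← trans (sym pj) p0
  least′ {suc j} pj = s≤s (least pj)

rep : ∀ {n} → Rel n → Fin n → Fin n
rep R i = fromMaybe i (first (λ j → rel R j i))

module Blocks {n} (R : Rel n) (R-part : IsPartition R) where
  open IsEquivalence R-part renaming (refl to ∼-refl; sym to ∼-sym; trans to ∼-trans)

  rep-spec : ∀ i → rep R i ∼[ R ] i × (∀ {j} → j ∼[ R ] i → toℕ (rep R i) ≤ toℕ j)
  rep-spec i with k , firstₖ , k∼i , least ← first-least (λ j → rel R j i) (∼-refl {i}) rewrite firstₖ = k∼i , least

  rep∼ : ∀ i → rep R i ∼[ R ] i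
  rep∼ i = proj₁ (rep-spec i)

  rep-minimal : ∀ {i j} → j ∼[ R ] i → toℕ (rep R i) ≤ toℕ j
  rep-minimal {i} = proj₂ (rep-spec i)

  rep-cong : ∀ {i j} → i ∼[ R ] j → rep R i ≡ rep R j
  rep-cong {i} {j} i∼j = toℕ-injective (≤-antisym
    (rep-minimal (∼-trans (rep∼ j) (∼-sym i∼j)))
    (rep-minimal (∼-trans (rep∼ i) i∼j)))

  rep≡⇒∼ : ∀ {i j} → rep R i ≡ rep R j → i ∼[ R ] j
  rep≡⇒∼ {i} {j} repᵢ≡repⱼ = ∼-trans (∼-sym (rep∼ i)) (subst (λ k → k ∼[ R ] j) (sym repᵢ≡repⱼ) (rep∼ j))

  isMin-rep : ∀ i → isMin R (rep R i) ≡ true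
  isMin-rep i = isMin-complete {R = R} (λ j j<rep j∼rep → <⇒≱ j<rep (rep-minimal (∼-trans j∼rep (rep∼ i))))

  isMin⇒rep≡ : ∀ {i} → isMin R i ≡ true → rep R i ≡ i
  isMin⇒rep≡ {i} min with <-cmp (toℕ (rep R i)) (toℕ i)
  ... | tri< rep<i _ _ = ⊥-elim (isMin-sound {R = R} min rep<i (rep∼ i))
  ... | tri≈ _ rep≡i _ = toℕ-injective rep≡i
  ... | tri> _ _ rep>i = ⊥-elim (<⇒≱ rep>i (rep-minimal ∼-refl))

  ∼⇔rep∼ : ∀ {S : Rel n} → IsPartition S → R ⊑ S → ∀ {i j} → i ∼[ S ] j ⇔ rep R i ∼[ S ] rep R j
  ∼⇔rep∼ S-part R⊑S {i} {j} = mk⇔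
    (λ i∼j → S.trans (coarsen R⊑S (rep∼ i)) (S.trans i∼j (S.sym (coarsen R⊑S (rep∼ j)))))
    (λ rᵢ∼rⱼ → S.trans (S.sym (coarsen R⊑S (rep∼ i))) (S.trans rᵢ∼rⱼ (coarsen R⊑S (rep∼ j))))
    where module S = IsEquivalence S-part

  ¬isMin⇒rep< : ∀ {i} → isMin R i ≡ false → toℕ (rep R i) < toℕ i
  ¬isMin⇒rep< {i} ¬min = ≤∧≢⇒< (rep-minimal ∼-refl) rep≢i
    where
    rep≢i : toℕ (rep R i) ≢ toℕ i
    rep≢i rep≡i with () ← trans (sym ¬min) (subst (λ k → isMin R k ≡ true) (toℕ-injective rep≡i) (isMin-rep i))

countFin : ∀ {m} → (Fin m → Bool) → ℕ
countFin {zero}  p = 0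
countFin {suc m} p = [ p zero ]× 1 + countFin (p ∘ suc)

countᵇ-tabulate : ∀ {m} (p : A → Bool) (f : Fin m → A) → countᵇ p (Data.List.tabulate f) ≡ countFin (p ∘ f)
countᵇ-tabulate {m = zero}  p f = refl
countᵇ-tabulate {m = suc m} p f with p (f zero)
... | true  = cong suc (countᵇ-tabulate p (f ∘ suc))
... | false = countᵇ-tabulate p (f ∘ suc)

length-concatMap : ∀ (h : A → List B) xs → length (concatMap h xs) ≡ ∑[ x ∈ xs ] length (h x)
length-concatMap h []       = refl
length-concatMap h (x ∷ xs) = trans (length-++ (h x)) (cong (length (h x) +_) (length-concatMap h xs))

split-weight : ∀ a b e x → (a + e * b) * (2 * x) ≡ a * (2 * x) + 2 * e * (b * x)
split-weight = solve-∀

square-shift : ∀ r e → r * (r + 2 * suc e) + suc (2 * e) ≡ suc r * (suc r + 2 * e)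
square-shift = solve-∀

-- A code is 0 off the positions marked by min; at a marked position it is either its own label or,
-- spending one of exactly t moves, an element of earlier or the label of an earlier marked position.
codes : ∀ m → (Fin m → Bool) → (Fin m → ℕ) → List ℕ → ℕ → List (Vec ℕ m)
codes zero    min label earlier zero    = [] ∷ []
codes zero    min label earlier (suc t) = []
codes (suc m) min label earlier t =
  if min zero
  then map (label zero ∷_) (rest (label zero ∷ earlier) t) ++ movedHere t
  else map (0 ∷_) (rest earlier t)
  where
  rest : List ℕ → ℕ → List (Vec ℕ m)
  rest = codes m (min ∘ suc) (label ∘ suc)
  movedHere : ℕ → List (Vec ℕ (suc m))
  movedHere zero    = []
  movedHere (suc t) = concatMap (λ e → map (e ∷_) (rest (label zero ∷ earlier) t)) earlier

codes-length : ∀ m min label earlier t →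
               length (codes m min label earlier t) * 2 ^ t ≤ (countFin min * (countFin min + 2 * length earlier)) ^ t
codes-length zero    min label earlier zero    = ≤-refl
codes-length zero    min label earlier (suc t) = z≤n
codes-length (suc m) min label earlier t with min zero
... | false = begin
  length (map (0 ∷_) (rest t)) * 2 ^ t       ≡⟨ cong (_* 2 ^ t) (length-map (0 ∷_) (rest t)) ⟩
  length (rest t) * 2 ^ t                    ≤⟨ codes-length m (min ∘ suc) (label ∘ suc) earlier t ⟩
  (r * (r + 2 * length earlier)) ^ t         ∎
  where
  open ≤-Reasoning
  rest : ℕ → List (Vec ℕ m)
  rest = codes m (min ∘ suc) (label ∘ suc) earlier
  r : ℕ
  r = countFin (min ∘ suc)
codes-length (suc m) min label earlier zero | true = begin
  length (map (label zero ∷_) rest ++ []) * 1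
    ≡⟨ cong (_* 1) (trans (length-++ (map _ rest)) (trans (+-identityʳ _) (length-map _ rest))) ⟩
  length rest * 1                              ≤⟨ codes-length m (min ∘ suc) (label ∘ suc) (label zero ∷ earlier) 0 ⟩
  1                                            ∎
  where
  open ≤-Reasoning
  rest : List (Vec ℕ m)
  rest = codes m (min ∘ suc) (label ∘ suc) (label zero ∷ earlier) 0
codes-length (suc m) min label earlier (suc t) | true = begin
  length (map (label zero ∷_) (rest (suc t)) ++ concatMap (λ x → map (x ∷_) (rest t)) earlier) * 2 ^ suc t
    ≡⟨ cong (_* 2 ^ suc t) (trans (length-++ (map _ (rest (suc t)))) (cong₂ _+_ (length-map _ (rest (suc t))) moved-length)) ⟩
  (a + e * b) * 2 ^ suc t                    ≡⟨ split-weight a b e (2 ^ t) ⟩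
  a * 2 ^ suc t + 2 * e * (b * 2 ^ t)        ≤⟨ +-mono-≤ (IH (suc t)) (*-monoʳ-≤ (2 * e) (IH t)) ⟩
  Y ^ suc t + 2 * e * Y ^ t                  ≡⟨ *-distribʳ-+ (Y ^ t) Y (2 * e) ⟨
  (Y + 2 * e) * Y ^ t                        ≤⟨ *-mono-≤ (+-monoʳ-≤ Y (n≤1+n _)) (^-monoˡ-≤ t (m≤m+n Y _)) ⟩
  (Y + suc (2 * e)) ^ suc t                  ≡⟨ cong (_^ suc t) (square-shift r e) ⟩
  (suc r * (suc r + 2 * e)) ^ suc t          ∎
  where
  open ≤-Reasoning
  rest : ℕ → List (Vec ℕ m)
  rest = codes m (min ∘ suc) (label ∘ suc) (label zero ∷ earlier)
  r e a b Y : ℕ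
  r = countFin (min ∘ suc)
  e = length earlier
  a = length (rest (suc t))
  b = length (rest t)
  Y = r * (r + 2 * suc e)
  IH : ∀ t → length (rest t) * 2 ^ t ≤ Y ^ t
  IH = codes-length m (min ∘ suc) (label ∘ suc) (label zero ∷ earlier)
  moved-length : length (concatMap (λ x → map (x ∷_) (rest t)) earlier) ≡ e * b
  moved-length = begin-equality
    length (concatMap (λ x → map (x ∷_) (rest t)) earlier)  ≡⟨ length-concatMap _ earlier ⟩
    ∑[ x ∈ earlier ] length (map (x ∷_) (rest t))          ≡⟨ ∑-cong earlier (λ x → length-map (x ∷_) (rest t)) ⟩
    ∑[ x ∈ earlier ] b                                     ≡⟨ ∑-const earlier b ⟩
    e * b                                                  ∎

record IsCode {m} (min : Fin m → Bool) (label : Fin m → ℕ) (earlier : List ℕ)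
              (c : Fin m → ℕ) (moved : Fin m → Bool) : Set where
  field
    off-minima : ∀ {i} → min i ≡ false → c i ≡ 0 × moved i ≡ false
    unmoved    : ∀ {i} → min i ≡ true → moved i ≡ false → c i ≡ label i
    moved-back : ∀ {i} → min i ≡ true → moved i ≡ true →
                 c i ∈ earlier ⊎ ∃ λ j → toℕ j < toℕ i × min j ≡ true × c i ≡ label j

IsCode-tail : ∀ {m min label earlier earlier′ c moved} → IsCode {suc m} min label earlier c moved →
              (∀ {x} → x ∈ earlier → x ∈ earlier′) → (min zero ≡ true → label zero ∈ earlier′) →
              IsCode (min ∘ suc) (label ∘ suc) earlier′ (c ∘ suc) (moved ∘ suc)
IsCode-tail {min = min} {label} {earlier} {earlier′} {c} isCode ⊆earlier′ label₀∈ = record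
  { off-minima = off-minima
  ; unmoved    = unmoved
  ; moved-back = λ minᵢ movedᵢ → shift (moved-back minᵢ movedᵢ)
  }
  where
  open IsCode isCode
  shift : ∀ {i} → c (suc i) ∈ earlier ⊎ (∃ λ j → toℕ j < toℕ (suc i) × min j ≡ true × c (suc i) ≡ label j) →
          c (suc i) ∈ earlier′ ⊎ (∃ λ j → toℕ j < toℕ i × min (suc j) ≡ true × c (suc i) ≡ label (suc j))
  shift (inj₁ c∈)                           = inj₁ (⊆earlier′ c∈)
  shift (inj₂ (zero  , _ , min₀ , c≡label)) = inj₁ (subst (_∈ earlier′) (sym c≡label) (label₀∈ min₀))
  shift (inj₂ (suc j , s≤s j<i , minⱼ , c≡label)) = inj₂ (j , j<i , minⱼ , c≡label)

codes-complete : ∀ m {min label earlier c moved} → IsCode min label earlier c moved →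
                 Vec.tabulate c ∈ codes m min label earlier (countFin moved)
codes-complete zero    isCode = here refl
codes-complete (suc m) {min} {label} {earlier} {c} {moved} isCode with min zero in min₀
... | false
  rewrite proj₁ (IsCode.off-minima isCode min₀) | proj₂ (IsCode.off-minima isCode min₀)
  = ∈-map⁺ (0 ∷_) (codes-complete m (IsCode-tail isCode (λ x∈ → x∈) (λ min₀′ → case trans (sym min₀′) min₀ of λ ())))
... | true with moved zero in moved₀
...   | false rewrite IsCode.unmoved isCode min₀ moved₀
  = ∈-++⁺ˡ (∈-map⁺ (label zero ∷_) (codes-complete m (IsCode-tail isCode there (λ _ → here refl))))
...   | true with IsCode.moved-back isCode min₀ moved₀
...     | inj₁ c₀∈ = ∈-++⁺ʳ _ (∈-concatMap⁺ _ (Any.map (λ { refl → ∈-map⁺ (c zero ∷_) tail∈ }) c₀∈))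
  where
  tail∈ : Vec.tabulate (c ∘ suc) ∈ codes m (min ∘ suc) (label ∘ suc) (label zero ∷ earlier) (countFin (moved ∘ suc))
  tail∈ = codes-complete m (IsCode-tail isCode there (λ _ → here refl))
...     | inj₂ (j , () , _)

countᵇ-split : ∀ (p q : A → Bool) xs → (∀ {x} → q x ≡ true → p x ≡ true) →
               countᵇ p xs ≡ countᵇ q xs + countᵇ (λ x → p x ∧ not (q x)) xs
countᵇ-split p q []       q⇒p = refl
countᵇ-split p q (x ∷ xs) q⇒p with q x in qx | p x in px
... | true  | true  = cong suc (countᵇ-split p q xs q⇒p)
... | true  | false with () ← trans (sym (q⇒p qx)) px
... | false | true  = trans (cong suc (countᵇ-split p q xs q⇒p)) (sym (+-suc _ _))
... | false | false = countᵇ-split p q xs q⇒p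

countᵇ≡0 : ∀ (p : A → Bool) {xs x} → countᵇ p xs ≡ 0 → x ∈ xs → p x ≡ false
countᵇ≡0 p {y ∷ ys} count≡0 x∈ with p y in py
countᵇ≡0 p {y ∷ ys} () x∈ | true
countᵇ≡0 p {y ∷ ys} count≡0 (here refl) | false = py
countᵇ≡0 p {y ∷ ys} count≡0 (there x∈)  | false = countᵇ≡0 p count≡0 x∈

module _ {n : ℕ} where

  ⊑-antisym : ∀ {R S : Rel n} → R ⊑ S → S ⊑ R → R ≡ S
  ⊑-antisym R⊑S S⊑R = rel-ext (λ i j → Bool.⇔→≡ {z = true} (mk⇔ (coarsen R⊑S) (coarsen S⊑R)))

  lostMin : Rel n → Rel n → Fin n → Bool
  lostMin z Λ i = isMin z i ∧ not (isMin Λ i)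

  #-split : ∀ {z Λ : Rel n} → z ⊑ Λ → # z ≡ # Λ + countᵇ (lostMin z Λ) (allFin n)
  #-split {z} {Λ} z⊑Λ = countᵇ-split (isMin z) (isMin Λ) (allFin n) (isMin-antitone z⊑Λ)

  #-antitone : ∀ {z Λ : Rel n} → z ⊑ Λ → # Λ ≤ # z
  #-antitone {z} {Λ} z⊑Λ = subst (# Λ ≤_) (sym (#-split z⊑Λ)) (m≤m+n (# Λ) _)

  minima-kept⇒⊑ : ∀ {z Λ : Rel n} → IsPartition z → IsPartition Λ → z ⊑ Λ →
                  (∀ {i} → isMin z i ≡ true → isMin Λ i ≡ true) → Λ ⊑ z
  minima-kept⇒⊑ {z} {Λ} z-part Λ-part z⊑Λ kept = mk⊑ λ {i} {j} i∼j → Z.rep≡⇒∼ (begin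
    rep z i          ≡⟨ L.isMin⇒rep≡ (kept (Z.isMin-rep i)) ⟨
    rep Λ (rep z i)  ≡⟨ L.rep-cong (Equivalence.to (Z.∼⇔rep∼ Λ-part z⊑Λ) i∼j) ⟩
    rep Λ (rep z j)  ≡⟨ L.isMin⇒rep≡ (kept (Z.isMin-rep j)) ⟩
    rep z j          ∎)
    where
    open ≡-Reasoning
    module Z = Blocks z z-part
    module L = Blocks Λ Λ-part

  #-strictly-antitone : ∀ {z Λ : Rel n} → IsPartition z → IsPartition Λ → z ⊑ Λ → Λ ≢ z → # Λ < # z
  #-strictly-antitone {z} {Λ} z-part Λ-part z⊑Λ Λ≢z =
    <-≤-trans (m<m+n (# Λ) (n≢0⇒n>0 someLost)) (≤-reflexive (sym (#-split z⊑Λ)))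
    where
    someLost : countᵇ (lostMin z Λ) (allFin n) ≢ 0
    someLost noneLost = Λ≢z (⊑-antisym (minima-kept⇒⊑ z-part Λ-part z⊑Λ kept) z⊑Λ)
      where
      kept : ∀ {i} → isMin z i ≡ true → isMin Λ i ≡ true
      kept {i} minz with isMin Λ i in minΛ
      ... | true  = refl
      ... | false with () ← trans (sym (countᵇ≡0 (lostMin z Λ) noneLost (∈-allFin i))) (cong₂ _∧_ minz (cong not minΛ))

module Coding {n} (z : Rel n) (z-part : IsPartition z) where
  module Z = Blocks z z-part

  -- Λ ⊒ z is encoded by sending each block minimum of z to the minimum of its Λ-block.
  entry : Rel n → Fin n → ℕ
  entry Λ i = [ isMin z i ]× toℕ (rep Λ i)

  code : Rel n → Vec ℕ n
  code Λ = Vec.tabulate (entry Λ)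

  entry-min : ∀ Λ {a} → isMin z a ≡ true → entry Λ a ≡ toℕ (rep Λ a)
  entry-min Λ {a} min = cong ([_]× toℕ (rep Λ a)) min

  module _ {Λ : Rel n} (Λ-part : IsPartition Λ) (z⊑Λ : z ⊑ Λ) where
    module L = Blocks Λ Λ-part

    ∼⇔entries≡ : ∀ {i j} → i ∼[ Λ ] j ⇔ entry Λ (rep z i) ≡ entry Λ (rep z j)
    ∼⇔entries≡ {i} {j} = mk⇔
      (λ i∼j → trans entryᵢ (trans (cong toℕ (L.rep-cong (to i∼j))) (sym entryⱼ)))
      (λ e≡ → from (L.rep≡⇒∼ (toℕ-injective (trans (sym entryᵢ) (trans e≡ entryⱼ)))))
      where
      open Equivalence (Z.∼⇔rep∼ Λ-part z⊑Λ)
      entryᵢ : entry Λ (rep z i) ≡ toℕ (rep Λ (rep z i))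
      entryᵢ = entry-min Λ (Z.isMin-rep i)
      entryⱼ : entry Λ (rep z j) ≡ toℕ (rep Λ (rep z j))
      entryⱼ = entry-min Λ (Z.isMin-rep j)

    code-isCode : IsCode (isMin z) toℕ [] (entry Λ) (lostMin z Λ)
    code-isCode = record { off-minima = off-minima ; unmoved = unmoved ; moved-back = moved-back }
      where
      off-minima : ∀ {i} → isMin z i ≡ false → entry Λ i ≡ 0 × lostMin z Λ i ≡ false
      off-minima minz rewrite minz = refl , refl
      unmoved : ∀ {i} → isMin z i ≡ true → lostMin z Λ i ≡ false → entry Λ i ≡ toℕ i
      unmoved {i} minz kept rewrite minz with isMin Λ i in minΛ
      ... | true  = cong toℕ (L.isMin⇒rep≡ minΛ)
      ... | false with () ← kept
      moved-back : ∀ {i} → isMin z i ≡ true → lostMin z Λ i ≡ true →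
                   entry Λ i ∈ [] ⊎ ∃ λ j → toℕ j < toℕ i × isMin z j ≡ true × entry Λ i ≡ toℕ j
      moved-back {i} minz lost rewrite minz with isMin Λ i in minΛ
      ... | true with () ← lost
      ... | false = inj₂ (rep Λ i , L.¬isMin⇒rep< minΛ , isMin-antitone z⊑Λ (L.isMin-rep i) , refl)

  code⇒⊑ : ∀ {Λ₁ Λ₂} → IsPartition Λ₁ → IsPartition Λ₂ → z ⊑ Λ₁ → z ⊑ Λ₂ → code Λ₁ ≡ code Λ₂ → Λ₁ ⊑ Λ₂
  code⇒⊑ {Λ₁} {Λ₂} part₁ part₂ z⊑₁ z⊑₂ code≡ = mk⊑ λ {i} {j} i∼j →
    Equivalence.from (∼⇔entries≡ part₂ z⊑₂)
      (trans (sym (entry≡ (rep z i))) (trans (Equivalence.to (∼⇔entries≡ part₁ z⊑₁) i∼j) (entry≡ (rep z j))))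
    where
    entry≡ : ∀ a → entry Λ₁ a ≡ entry Λ₂ a
    entry≡ a = trans (sym (Vec.lookup∘tabulate (entry Λ₁) a))
                     (trans (cong (λ v → Vec.lookup v a) code≡) (Vec.lookup∘tabulate (entry Λ₂) a))

  code-injective : ∀ {Λ₁ Λ₂} → IsPartition Λ₁ → IsPartition Λ₂ → z ⊑ Λ₁ → z ⊑ Λ₂ → code Λ₁ ≡ code Λ₂ → Λ₁ ≡ Λ₂
  code-injective part₁ part₂ z⊑₁ z⊑₂ code≡ =
    ⊑-antisym (code⇒⊑ part₁ part₂ z⊑₁ z⊑₂ code≡) (code⇒⊑ part₂ part₁ z⊑₂ z⊑₁ (sym code≡))

  countFin-lostMin : ∀ {Λ} → z ⊑ Λ → countFin (lostMin z Λ) ≡ # z ∸ # Λ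
  countFin-lostMin {Λ} z⊑Λ = begin
    countFin (lostMin z Λ)                 ≡⟨ countᵇ-tabulate (lostMin z Λ) (λ i → i) ⟨
    countᵇ (lostMin z Λ) (allFin n)        ≡⟨ m+n∸m≡n (# Λ) _ ⟨
    # Λ + countᵇ (lostMin z Λ) (allFin n) ∸ # Λ ≡⟨ cong (_∸ # Λ) (#-split z⊑Λ) ⟨
    # z ∸ # Λ                              ∎
    where open ≡-Reasoning

coarserCount : ∀ {n} → Rel n → ℕ → ℕ
coarserCount {n} z c = ∑[ Λ ∈ P n ] [ (z ≤P Λ) ∧ (# Λ ≡ᵇ c) ∧ not (z == Λ) ]× 1

module _ {n} {z : Rel n} (z-part : IsPartition z) where
  open Coding z z-part

  coarserCount-vanish : ∀ {c} → # z ≤ c → coarserCount z c ≡ 0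
  coarserCount-vanish {c} z≤c = ∑-vanish (P n) term≡0
    where
    term≡0 : ∀ Λ → Λ ∈ P n → [ (z ≤P Λ) ∧ (# Λ ≡ᵇ c) ∧ not (z == Λ) ]× 1 ≡ 0
    term≡0 Λ Λ∈ with z ≤P Λ in z≤Λ | # Λ ≡ᵇ c in #Λ≡c | z == Λ in z==Λ
    ... | true  | true  | false =
      ⊥-elim (<⇒≱ (#-strictly-antitone z-part (∈P⇒IsPartition Λ∈) (≤P-sound z Λ z≤Λ) Λ≢z)
                  (≤-trans z≤c (≤-reflexive (sym (≡ᵇ≡true⇒≡ (# Λ) c #Λ≡c)))))
      where
      Λ≢z : Λ ≢ z
      Λ≢z refl with () ← trans (sym (==-refl z)) z==Λ
    ... | true  | true  | true  = refl
    ... | true  | false | _     = refl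
    ... | false | _     | _     = refl

  coarserCount-bound : ∀ c → coarserCount z c * 2 ^ (# z ∸ c) ≤ (# z * # z) ^ (# z ∸ c)
  coarserCount-bound c = begin
    coarserCount z c * 2 ^ t
      ≤⟨ *-monoˡ-≤ (2 ^ t) (count-by-code (Vec.≡-dec _≟_) code coarser candidates (Distinct-P n) code∈ injective) ⟩
    length candidates * 2 ^ t
      ≤⟨ codes-length n (isMin z) toℕ [] t ⟩
    (countFin (isMin z) * (countFin (isMin z) + 0)) ^ t
      ≡⟨ cong (λ k → (k * (k + 0)) ^ t) (countᵇ-tabulate (isMin z) (λ i → i)) ⟨
    (# z * (# z + 0)) ^ t
      ≡⟨ cong (λ k → (# z * k) ^ t) (+-identityʳ (# z)) ⟩
    (# z * # z) ^ t
      ∎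
    where
    open ≤-Reasoning
    t : ℕ
    t = # z ∸ c
    coarser : Rel n → Bool
    coarser Λ = (z ≤P Λ) ∧ (# Λ ≡ᵇ c) ∧ not (z == Λ)
    candidates : List (Vec ℕ n)
    candidates = codes n (isMin z) toℕ [] t
    code∈ : ∀ {Λ} → Λ ∈ P n → coarser Λ ≡ true → code Λ ∈ candidates
    code∈ {Λ} Λ∈ coarserΛ = subst (λ k → code Λ ∈ codes n (isMin z) toℕ [] k) lost≡t
      (codes-complete n (code-isCode (∈P⇒IsPartition Λ∈) z⊑Λ))
      where
      z⊑Λ : z ⊑ Λ
      z⊑Λ = ≤P-sound z Λ (∧-conicalˡ _ _ coarserΛ)
      lost≡t : countFin (lostMin z Λ) ≡ t
      lost≡t = trans (countFin-lostMin z⊑Λ)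
                     (cong (# z ∸_) (≡ᵇ≡true⇒≡ (# Λ) c (∧-conicalˡ _ _ (∧-conicalʳ (z ≤P Λ) _ coarserΛ))))
    injective : ∀ {Λ₁ Λ₂} → Λ₁ ∈ P n → Λ₂ ∈ P n → coarser Λ₁ ≡ true → coarser Λ₂ ≡ true →
                code Λ₁ ≡ code Λ₂ → Λ₁ ≡ Λ₂
    injective Λ₁∈ Λ₂∈ c₁ c₂ = code-injective (∈P⇒IsPartition Λ₁∈) (∈P⇒IsPartition Λ₂∈)
      (≤P-sound z _ (∧-conicalˡ _ _ c₁)) (≤P-sound z _ (∧-conicalˡ _ _ c₂))

kernel : ∀ {n} → (Fin n → ℕ) → Rel n
kernel f = Vec.tabulate (λ i → Vec.tabulate (λ j → f i ≡ᵇ f j))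

-- Πof n λs is definitionally kernel (blockOf λs ∘ toℕ).
module _ {n} (f : Fin n → ℕ) where

  kernel-∼⇔ : ∀ {i j} → i ∼[ kernel f ] j ⇔ f i ≡ f j
  kernel-∼⇔ {i} {j} =
    subst (λ b → b ≡ true ⇔ f i ≡ f j) (sym rel≡) (mk⇔ (≡ᵇ≡true⇒≡ (f i) (f j)) ≡⇒≡ᵇ≡true)
    where
    rel≡ : rel (kernel f) i j ≡ (f i ≡ᵇ f j)
    rel≡ = trans (cong (λ row → Vec.lookup row j) (Vec.lookup∘tabulate _ i)) (Vec.lookup∘tabulate _ j)

  #kernel≤ : ∀ ks → (∀ i → f i ∈ ks) → # kernel f ≤ length ks
  #kernel≤ ks f∈ = begin
    # kernel f
      ≡⟨ countᵇ-∑ (isMin (kernel f)) (allFin n) ⟩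
    ∑[ i ∈ allFin n ] [ isMin (kernel f) i ]× 1
      ≤⟨ count-by-code _≟_ f (isMin (kernel f)) ks (Unique⇒Distinct (allFin⁺ n)) (λ {i} _ _ → f∈ i) injective ⟩
    length ks
      ∎
    where
    open ≤-Reasoning
    injective : ∀ {a b} → a ∈ allFin n → b ∈ allFin n → isMin (kernel f) a ≡ true → isMin (kernel f) b ≡ true →
                f a ≡ f b → a ≡ b
    injective {a} {b} _ _ a-min b-min fa≡fb with <-cmp (toℕ a) (toℕ b)
    ... | tri< a<b _ _ = ⊥-elim (isMin-sound {R = kernel f} b-min a<b (Equivalence.from kernel-∼⇔ fa≡fb))
    ... | tri≈ _ a≡b _ = toℕ-injective a≡b
    ... | tri> _ _ b<a = ⊥-elim (isMin-sound {R = kernel f} a-min b<a (Equivalence.from kernel-∼⇔ (sym fa≡fb)))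

blockOf< : ∀ qs i → i < sum qs → blockOf qs i < length qs
blockOf< (q ∷ qs) i i<sum with i <ᵇ q in i<q
... | true  = z<s
... | false = s<s (blockOf< qs (i ∸ q) (subst (i ∸ q <_) (m+n∸m≡n q (sum qs)) (∸-monoˡ-< i<sum q≤i)))
  where
  q≤i : q ≤ i
  q≤i = ≮⇒≥ (λ i<q′ → case trans (sym (<⇒<ᵇ≡true i<q′)) i<q of λ ())

#Πof≤length : ∀ {n λs} → sum λs ≡ n → # (Πof n λs) ≤ length λs
#Πof≤length {n} {λs} sum≡n = subst (# (Πof n λs) ≤_) (length-upTo (length λs))
  (#kernel≤ (blockOf λs ∘ toℕ) (upTo (length λs)) block∈)
  where
  block∈ : ∀ i → blockOf λs (toℕ i) ∈ upTo (length λs)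
  block∈ i = ∈-upTo⁺ (blockOf< λs (toℕ i) (subst (toℕ i <_) (sym sum≡n) (toℕ<n i)))

sumℤ-abs : ∀ (g : A → ℤ) xs → ∣ sumℤ (map g xs) ∣ ≤ ∑[ x ∈ xs ] ∣ g x ∣
sumℤ-abs g []       = z≤n
sumℤ-abs g (x ∷ xs) =
  ≤-trans (ℤ.∣i+j∣≤∣i∣+∣j∣ (g x) (sumℤ (map g xs))) (+-monoʳ-≤ ∣ g x ∣ (sumℤ-abs g xs))

module Möbius {n} (Π : Rel n) where

  ∣μ∣ : ℕ → Rel n → ℕ
  ∣μ∣ f Λ = ∣ μ-fuel f Π Λ ∣

  between : Rel n → Rel n → Bool
  between z Λ = (Π ≤P z) ∧ (z ≤P Λ) ∧ not (z == Λ)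

  ∣μ∣-zero : ∀ Λ → ∣μ∣ 0 Λ ≤ [ Π == Λ ]× 1
  ∣μ∣-zero Λ with Π == Λ
  ... | true  = ≤-refl
  ... | false = z≤n

  ∣μ∣-suc : ∀ f Λ → ∣μ∣ (suc f) Λ ≤ [ Π == Λ ]× 1 + (∑[ z ∈ P n ] [ between z Λ ]× ∣μ∣ f z)
  ∣μ∣-suc f Λ with Π == Λ | Π ≤P Λ
  ... | true  | _     = s≤s z≤n
  ... | false | false = z≤n
  ... | false | true  = begin
    ∣ - sumℤ (map (μ-fuel f Π) below) ∣  ≡⟨ ℤ.∣-i∣≡∣i∣ (sumℤ (map (μ-fuel f Π) below)) ⟩
    ∣ sumℤ (map (μ-fuel f Π) below) ∣    ≤⟨ sumℤ-abs (μ-fuel f Π) below ⟩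
    ∑[ z ∈ below ] ∣μ∣ f z               ≡⟨ ∑-filterᵇ (λ z → between z Λ) (∣μ∣ f) (P n) ⟩
    ∑[ z ∈ P n ] [ between z Λ ]× ∣μ∣ f z ∎
    where
    open ≤-Reasoning
    below : List (Rel n)
    below = filterᵇ (λ z → between z Λ) (P n)

  level : ℕ → Rel n → Bool
  level c Λ = (Π ≤P Λ) ∧ (# Λ ≡ᵇ c)

  levelSum : ℕ → ℕ → ℕ
  levelSum f c = ∑[ Λ ∈ P n ] [ level c Λ ]× ∣μ∣ f Λ

  identity-count : ∀ c → ∑[ Λ ∈ P n ] [ level c Λ ]× [ Π == Λ ]× 1 ≤ [ # Π ≡ᵇ c ]× 1
  identity-count c with # Π ≡ᵇ c in #Π≡c
  ... | true  = ≤-trans (∑-mono (P n) (λ Λ _ → []×-≤ (level c Λ) _))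
                        (Distinct-P n (Π ==_) (λ _ _ Π==Λ Π==Λ′ → trans (sym (==-sound Π==Λ)) (==-sound Π==Λ′)))
  ... | false = ≤-reflexive (∑-vanish (P n) term≡0)
    where
    term≡0 : ∀ Λ → Λ ∈ P n → [ level c Λ ]× [ Π == Λ ]× 1 ≡ 0
    term≡0 Λ _ with level c Λ in lvl | Π == Λ in Π==Λ
    ... | false | _     = refl
    ... | true  | false = refl
    ... | true  | true with refl ← ==-sound Π==Λ with () ← trans (sym #Π≡c) (∧-conicalʳ (Π ≤P Π) _ lvl)

  levelSum-zero : ∀ c → levelSum 0 c ≤ [ # Π ≡ᵇ c ]× 1
  levelSum-zero c = ≤-trans (∑-mono (P n) (λ Λ _ → []×-mono (level c Λ) (∣μ∣-zero Λ))) (identity-count c)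

  levelSum-suc : ∀ f c →
    levelSum (suc f) c ≤ [ # Π ≡ᵇ c ]× 1 + (∑[ z ∈ P n ] [ Π ≤P z ]× (∣μ∣ f z * coarserCount z c))
  levelSum-suc f c = begin
    levelSum (suc f) c
      ≤⟨ ∑-mono (P n) (λ Λ _ → []×-mono (level c Λ) (∣μ∣-suc f Λ)) ⟩
    ∑[ Λ ∈ P n ] [ level c Λ ]× ([ Π == Λ ]× 1 + (∑[ z ∈ P n ] [ between z Λ ]× ∣μ∣ f z))
      ≡⟨ ∑-cong (P n) (λ Λ → []×-+ (level c Λ) _ _) ⟩
    ∑[ Λ ∈ P n ] ([ level c Λ ]× [ Π == Λ ]× 1 + [ level c Λ ]× (∑[ z ∈ P n ] [ between z Λ ]× ∣μ∣ f z))
      ≡⟨ ∑-+ (P n) ⟩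
    identities + (∑[ Λ ∈ P n ] [ level c Λ ]× (∑[ z ∈ P n ] [ between z Λ ]× ∣μ∣ f z))
      ≡⟨ cong (identities +_) (∑-cong (P n) (λ Λ → ∑-[]× (level c Λ) _ (P n))) ⟩
    identities + (∑[ Λ ∈ P n ] ∑[ z ∈ P n ] [ level c Λ ]× [ between z Λ ]× ∣μ∣ f z)
      ≡⟨ cong (identities +_) (∑-swap (P n) (P n) _) ⟩
    identities + (∑[ z ∈ P n ] ∑[ Λ ∈ P n ] [ level c Λ ]× [ between z Λ ]× ∣μ∣ f z)
      ≤⟨ +-mono-≤ (identity-count c) (∑-mono (P n) (λ z _ → regroup z)) ⟩
    [ # Π ≡ᵇ c ]× 1 + (∑[ z ∈ P n ] [ Π ≤P z ]× (∣μ∣ f z * coarserCount z c))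
      ∎
    where
    open ≤-Reasoning
    identities : ℕ
    identities = ∑[ Λ ∈ P n ] [ level c Λ ]× [ Π == Λ ]× 1
    coarser : Rel n → Rel n → Bool
    coarser z Λ = (z ≤P Λ) ∧ (# Λ ≡ᵇ c) ∧ not (z == Λ)
    reorder : ∀ a b c d e x → [ a ∧ b ]× [ c ∧ d ∧ e ]× x ≤ [ c ]× (x * [ d ∧ b ∧ e ]× 1)
    reorder false _     _     _     _     _ = z≤n
    reorder true  false _     _     _     _ = z≤n
    reorder true  true  false _     _     _ = z≤n
    reorder true  true  true  false _     _ = z≤n
    reorder true  true  true  true  false _ = z≤n
    reorder true  true  true  true  true  x = ≤-reflexive (sym (*-identityʳ x))
    regroup : ∀ z → ∑[ Λ ∈ P n ] [ level c Λ ]× [ between z Λ ]× ∣μ∣ f z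
                  ≤ [ Π ≤P z ]× (∣μ∣ f z * coarserCount z c)
    regroup z = begin
      ∑[ Λ ∈ P n ] [ level c Λ ]× [ between z Λ ]× ∣μ∣ f z
        ≤⟨ ∑-mono (P n) (λ Λ _ → reorder (Π ≤P Λ) (# Λ ≡ᵇ c) (Π ≤P z) (z ≤P Λ) (not (z == Λ)) (∣μ∣ f z)) ⟩
      ∑[ Λ ∈ P n ] [ Π ≤P z ]× (∣μ∣ f z * [ coarser z Λ ]× 1)
        ≡⟨ ∑-[]× (Π ≤P z) _ (P n) ⟨
      [ Π ≤P z ]× (∑[ Λ ∈ P n ] ∣μ∣ f z * [ coarser z Λ ]× 1)
        ≡⟨ cong ([ Π ≤P z ]×_) (∑-*ˡ (∣μ∣ f z) _ (P n)) ⟩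
      [ Π ≤P z ]× (∣μ∣ f z * coarserCount z c)
        ∎

geometric : ∀ p c → suc (∑[ b ∈ downFrom (suc p) ] [ c <ᵇ b ]× 2 ^ (p ∸ b)) ≤ 2 ^ (p ∸ c)
geometric zero    c = m^n>0 2 (0 ∸ c)
geometric (suc q) c with c <ᵇ suc q in c<ᵇsq
... | true = begin
  suc (2 ^ (q ∸ q) + tail)  ≤⟨ s≤s (+-mono-≤ (≤-reflexive (cong (2 ^_) (n∸n≡0 q))) tail≤) ⟩
  2 + 2 * G                 ≡⟨ *-suc 2 G ⟨
  2 * suc G                 ≤⟨ *-monoʳ-≤ 2 (geometric q c) ⟩
  2 * 2 ^ (q ∸ c)           ≡⟨ cong (2 ^_) (+-∸-assoc 1 (≤-pred (<ᵇ≡true⇒< c (suc q) c<ᵇsq))) ⟨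
  2 ^ (suc q ∸ c)           ∎
  where
  open ≤-Reasoning
  G tail : ℕ
  G    = ∑[ b ∈ downFrom (suc q) ] [ c <ᵇ b ]× 2 ^ (q ∸ b)
  tail = ∑[ b ∈ downFrom (suc q) ] [ c <ᵇ b ]× 2 ^ (suc q ∸ b)
  tail≤ : tail ≤ 2 * G
  tail≤ = ≤-trans (∑-mono (downFrom (suc q)) (λ b b∈ → ≤-reflexive (step b (≤-pred (∈-downFrom⁻ b∈)))))
                  (≤-reflexive (∑-*ˡ 2 (λ b → [ c <ᵇ b ]× 2 ^ (q ∸ b)) (downFrom (suc q))))
    where
    step : ∀ b → b ≤ q → [ c <ᵇ b ]× 2 ^ (suc q ∸ b) ≡ 2 * [ c <ᵇ b ]× 2 ^ (q ∸ b)
    step b b≤q with c <ᵇ b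
    ... | true  = cong (2 ^_) (+-∸-assoc 1 b≤q)
    ... | false = refl
... | false = ≤-trans (s≤s (≤-reflexive (∑-vanish (downFrom (suc q)) vanish))) (m^n>0 2 (suc q ∸ c))
  where
  vanish : ∀ b → b ∈ downFrom (suc q) → [ c <ᵇ b ]× 2 ^ (suc q ∸ b) ≡ 0
  vanish b b∈ with c <ᵇ b in c<ᵇb
  ... | false = refl
  ... | true with () ← trans (sym (<⇒<ᵇ≡true (<-trans (<ᵇ≡true⇒< c b c<ᵇb) (∈-downFrom⁻ b∈)))) c<ᵇsq

∸-split : ∀ {p b c} → c ≤ b → b ≤ p → p ∸ c ≡ (b ∸ c) + (p ∸ b)
∸-split {p} {b} {c} c≤b b≤p = begin
  p ∸ c                ≡⟨ cong (_∸ c) (m∸n+n≡m b≤p) ⟨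
  (p ∸ b) + b ∸ c      ≡⟨ +-∸-assoc (p ∸ b) c≤b ⟩
  (p ∸ b) + (b ∸ c)    ≡⟨ +-comm (p ∸ b) (b ∸ c) ⟩
  (b ∸ c) + (p ∸ b)    ∎
  where open ≡-Reasoning

module _ {n} (Π : Rel n) where
  open Möbius Π

  private
    p X : ℕ
    p = # Π
    X = p * p

  weight : ℕ → ℕ → ℕ
  weight c b = [ c <ᵇ b ]× (X ^ (b ∸ c) * 2 ^ (p ∸ b))

  coarserCount-weighted : ∀ {z} c → z ∈ P n → (Π ≤P z) ≡ true → coarserCount z c * 2 ^ (p ∸ c) ≤ weight c (# z)
  coarserCount-weighted {z} c z∈ Π≤z with c <ᵇ # z in c<ᵇz
  ... | false = ≤-reflexive (cong (_* 2 ^ (p ∸ c)) (coarserCount-vanish (∈P⇒IsPartition z∈) z≤c))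
    where
    z≤c : # z ≤ c
    z≤c = ≮⇒≥ (λ c<z → case trans (sym (<⇒<ᵇ≡true c<z)) c<ᵇz of λ ())
  ... | true = begin
    coarserCount z c * 2 ^ (p ∸ c)                   ≡⟨ cong (λ e → coarserCount z c * 2 ^ e) (∸-split c≤b b≤p) ⟩
    coarserCount z c * 2 ^ ((b ∸ c) + (p ∸ b))       ≡⟨ cong (coarserCount z c *_) (^-distribˡ-+-* 2 (b ∸ c) (p ∸ b)) ⟩
    coarserCount z c * (2 ^ (b ∸ c) * 2 ^ (p ∸ b))   ≡⟨ *-assoc (coarserCount z c) _ _ ⟨
    coarserCount z c * 2 ^ (b ∸ c) * 2 ^ (p ∸ b)
      ≤⟨ *-monoˡ-≤ (2 ^ (p ∸ b)) (coarserCount-bound (∈P⇒IsPartition z∈) c) ⟩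
    (b * b) ^ (b ∸ c) * 2 ^ (p ∸ b)
      ≤⟨ *-monoˡ-≤ (2 ^ (p ∸ b)) (^-monoˡ-≤ (b ∸ c) (*-mono-≤ b≤p b≤p)) ⟩
    X ^ (b ∸ c) * 2 ^ (p ∸ b)                        ∎
    where
    open ≤-Reasoning
    b : ℕ
    b = # z
    b≤p : b ≤ p
    b≤p = #-antitone (≤P-sound Π z Π≤z)
    c≤b : c ≤ b
    c≤b = <⇒≤ (<ᵇ≡true⇒< c b c<ᵇz)

  identity-weight : ∀ c → [ p ≡ᵇ c ]× 1 * 2 ^ (p ∸ c) ≤ X ^ (p ∸ c)
  identity-weight c with p ≡ᵇ c in p≡ᵇc
  ... | false = z≤n
  ... | true  = ≤-reflexive (trans (cong (λ e → 1 * 2 ^ e) p∸c≡0) (cong (X ^_) (sym p∸c≡0)))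
    where
    p∸c≡0 : p ∸ c ≡ 0
    p∸c≡0 = m≤n⇒m∸n≡0 (≤-reflexive (≡ᵇ≡true⇒≡ p c p≡ᵇc))

  levelSum-suc-weighted : ∀ f c →
    levelSum (suc f) c * 2 ^ (p ∸ c) ≤ X ^ (p ∸ c) + (∑[ b ∈ downFrom (suc p) ] levelSum f b * weight c b)
  levelSum-suc-weighted f c = begin
    levelSum (suc f) c * 2 ^ (p ∸ c)
      ≤⟨ *-monoˡ-≤ (2 ^ (p ∸ c)) (levelSum-suc f c) ⟩
    ([ p ≡ᵇ c ]× 1 + (∑[ z ∈ P n ] [ Π ≤P z ]× (∣μ∣ f z * coarserCount z c))) * 2 ^ (p ∸ c)
      ≡⟨ distribute ⟩
    [ p ≡ᵇ c ]× 1 * 2 ^ (p ∸ c) + (∑[ z ∈ P n ] [ Π ≤P z ]× (∣μ∣ f z * (coarserCount z c * 2 ^ (p ∸ c))))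
      ≤⟨ +-mono-≤ (identity-weight c) (∑-mono (P n) weigh) ⟩
    X ^ (p ∸ c) + (∑[ z ∈ P n ] [ Π ≤P z ]× (∣μ∣ f z * weight c (# z)))
      ≤⟨ +-monoʳ-≤ (X ^ (p ∸ c)) (∑-group (P n) (downFrom (suc p)) #_ (Π ≤P_) (∣μ∣ f) (weight c) #∈) ⟩
    X ^ (p ∸ c) + (∑[ b ∈ downFrom (suc p) ] levelSum f b * weight c b)
      ∎
    where
    open ≤-Reasoning
    distribute : ([ p ≡ᵇ c ]× 1 + (∑[ z ∈ P n ] [ Π ≤P z ]× (∣μ∣ f z * coarserCount z c))) * 2 ^ (p ∸ c)
               ≡ [ p ≡ᵇ c ]× 1 * 2 ^ (p ∸ c)
                 + (∑[ z ∈ P n ] [ Π ≤P z ]× (∣μ∣ f z * (coarserCount z c * 2 ^ (p ∸ c))))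
    distribute = trans (*-distribʳ-+ (2 ^ (p ∸ c)) ([ p ≡ᵇ c ]× 1) _)
      (cong ([ p ≡ᵇ c ]× 1 * 2 ^ (p ∸ c) +_) (trans (sym (∑-*ʳ (2 ^ (p ∸ c)) _ (P n))) (∑-cong (P n) pull)))
      where
      pull : ∀ z → [ Π ≤P z ]× (∣μ∣ f z * coarserCount z c) * 2 ^ (p ∸ c)
                 ≡ [ Π ≤P z ]× (∣μ∣ f z * (coarserCount z c * 2 ^ (p ∸ c)))
      pull z = trans ([]×-*ʳ (Π ≤P z) _ _) (cong ([ Π ≤P z ]×_) (*-assoc (∣μ∣ f z) _ _))
    weigh : ∀ z → z ∈ P n → [ Π ≤P z ]× (∣μ∣ f z * (coarserCount z c * 2 ^ (p ∸ c)))
                          ≤ [ Π ≤P z ]× (∣μ∣ f z * weight c (# z))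
    weigh z z∈ with Π ≤P z in Π≤z
    ... | true  = *-monoʳ-≤ (∣μ∣ f z) (coarserCount-weighted c z∈ Π≤z)
    ... | false = z≤n
    #∈ : ∀ {z} → z ∈ P n → (Π ≤P z) ≡ true → # z ∈ downFrom (suc p)
    #∈ {z} _ Π≤z = ∈-downFrom⁺ (s≤s (#-antitone (≤P-sound Π z Π≤z)))

  -- Holds for every fuel, so it never matters how much fuel μ needs to stabilise.
  levelSum-bound : ∀ f c → levelSum f c ≤ X ^ (p ∸ c)
  levelSum-bound zero c =
    ≤-trans (levelSum-zero c) (≤-trans (m≤m*n _ (2 ^ (p ∸ c)) {{m^n≢0 2 (p ∸ c)}}) (identity-weight c))
  levelSum-bound (suc f) c = *-cancelʳ-≤ _ _ (2 ^ (p ∸ c)) {{m^n≢0 2 (p ∸ c)}} (begin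
    levelSum (suc f) c * 2 ^ (p ∸ c)
      ≤⟨ levelSum-suc-weighted f c ⟩
    X ^ (p ∸ c) + (∑[ b ∈ downFrom (suc p) ] levelSum f b * weight c b)
      ≤⟨ +-monoʳ-≤ (X ^ (p ∸ c)) (∑-mono (downFrom (suc p)) induction) ⟩
    X ^ (p ∸ c) + (∑[ b ∈ downFrom (suc p) ] X ^ (p ∸ c) * [ c <ᵇ b ]× 2 ^ (p ∸ b))
      ≡⟨ cong (X ^ (p ∸ c) +_) (∑-*ˡ (X ^ (p ∸ c)) _ (downFrom (suc p))) ⟩
    X ^ (p ∸ c) + X ^ (p ∸ c) * (∑[ b ∈ downFrom (suc p) ] [ c <ᵇ b ]× 2 ^ (p ∸ b))
      ≡⟨ *-suc (X ^ (p ∸ c)) _ ⟨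
    X ^ (p ∸ c) * suc (∑[ b ∈ downFrom (suc p) ] [ c <ᵇ b ]× 2 ^ (p ∸ b))
      ≤⟨ *-monoʳ-≤ (X ^ (p ∸ c)) (geometric p c) ⟩
    X ^ (p ∸ c) * 2 ^ (p ∸ c)
      ∎)
    where
    open ≤-Reasoning
    induction : ∀ b → b ∈ downFrom (suc p) →
                levelSum f b * weight c b ≤ X ^ (p ∸ c) * [ c <ᵇ b ]× 2 ^ (p ∸ b)
    induction b b∈ with c <ᵇ b in c<ᵇb
    ... | false = ≤-trans (≤-reflexive (*-zeroʳ (levelSum f b))) z≤n
    ... | true  = begin
      levelSum f b * (X ^ (b ∸ c) * 2 ^ (p ∸ b))      ≤⟨ *-monoˡ-≤ _ (levelSum-bound f b) ⟩
      X ^ (p ∸ b) * (X ^ (b ∸ c) * 2 ^ (p ∸ b))      ≡⟨ *-assoc (X ^ (p ∸ b)) _ _ ⟨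
      X ^ (p ∸ b) * X ^ (b ∸ c) * 2 ^ (p ∸ b)        ≡⟨ cong (_* 2 ^ (p ∸ b)) (^-distribˡ-+-* X (p ∸ b) (b ∸ c)) ⟨
      X ^ ((p ∸ b) + (b ∸ c)) * 2 ^ (p ∸ b)          ≡⟨ cong (λ e → X ^ e * 2 ^ (p ∸ b)) exponent ⟩
      X ^ (p ∸ c) * 2 ^ (p ∸ b)                      ∎
      where
      exponent : (p ∸ b) + (b ∸ c) ≡ p ∸ c
      exponent = trans (+-comm (p ∸ b) (b ∸ c))
                       (sym (∸-split (<⇒≤ (<ᵇ≡true⇒< c b c<ᵇb)) (≤-pred (∈-downFrom⁻ b∈))))

square-pow-mono : ∀ {p m} c → p ≤ m → (p * p) ^ (p ∸ c) ≤ (m * m) ^ (m ∸ c)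
square-pow-mono {m = zero}  c z≤n = ≤-refl
square-pow-mono {p} {suc m} c p≤m =
  ≤-trans (^-monoˡ-≤ (p ∸ c) (*-mono-≤ p≤m p≤m)) (^-monoʳ-≤ (suc m * suc m) (∸-monoˡ-≤ c p≤m))

square-pow : ∀ m j → (m * m) ^ j ≡ m ^ (2 * j)
square-pow m j = trans (cong (λ k → (m * k) ^ j) (sym (*-identityʳ m))) (^-*-assoc m 2 j)

mobiusSum≡levelSum : ∀ n λs c → mobiusSum n λs c ≡ Möbius.levelSum (Πof n λs) n c
mobiusSum≡levelSum n λs c = trans (sum-map (∣μ∣ n) (filterᵇ (level c) (P n))) (∑-filterᵇ (level c) (∣μ∣ n) (P n))
  where open Möbius (Πof n λs)

lemma3p3 : (n k d : ℕ) (λs : List ℕ) → λs ⊢ n → length λs ≡ n ∸ k →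
    k ≤ d → d ≤ n →
    mobiusSum n λs (n ∸ d) ≤ (n ∸ k) ^ (2 * (d ∸ k))
lemma3p3 n k d λs λs⊢n length≡ k≤d d≤n = begin
  mobiusSum n λs (n ∸ d)                          ≡⟨ mobiusSum≡levelSum n λs (n ∸ d) ⟩
  Möbius.levelSum Π n (n ∸ d)                     ≤⟨ levelSum-bound Π n (n ∸ d) ⟩
  (# Π * # Π) ^ (# Π ∸ (n ∸ d))                   ≤⟨ square-pow-mono (n ∸ d) (#Πof≤length {n} {λs} (_⊢_.sums λs⊢n)) ⟩
  (length λs * length λs) ^ (length λs ∸ (n ∸ d)) ≡⟨ cong (λ ℓ → (ℓ * ℓ) ^ (ℓ ∸ (n ∸ d))) length≡ ⟩
  ((n ∸ k) * (n ∸ k)) ^ ((n ∸ k) ∸ (n ∸ d))       ≡⟨ cong (((n ∸ k) * (n ∸ k)) ^_) exponent ⟩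
  ((n ∸ k) * (n ∸ k)) ^ (d ∸ k)                   ≡⟨ square-pow (n ∸ k) (d ∸ k) ⟩
  (n ∸ k) ^ (2 * (d ∸ k))                         ∎
  where
  open ≤-Reasoning
  Π : Rel n
  Π = Πof n λs
  exponent : (n ∸ k) ∸ (n ∸ d) ≡ d ∸ k
  exponent = trans (cong (_∸ (n ∸ d)) (∸-split k≤d d≤n)) (m+n∸n≡m (d ∸ k) (n ∸ d))
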